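{- Let $\epsilon\in[0,1)$ and let $G=(V,E)$ be a finite simple graph with $\epsilon|V|$ an integer and $(1+\epsilon)\tfrac{|V|}{2}$ an integer. Let $\pi$ be an optimal solution of the $\epsilon$-balanced edge-bisection problem on $\mathcal{K}(G)$, i.e. a 2-coloring of the edges of $\mathcal{K}(G)$ with each color class of size at most $(1+\epsilon)\tfrac{|E(\mathcal{K}(G))|}{2}$ that minimizes the number of cut vertices. Then each clique $K_u$ ($u\in V$) of $\mathcal{K}(G)$ has exactly one dominating color.
   Context: A vertex is cut by an edge 2-coloring if it is incident to edges of both colors. Clique expansion: given $G=(V,E)$, let $S=4+2|V|\binom{|E|}{2}$. $\mathcal{K}(G)$ is obtained by taking a disjoint union of $|V|$ copies $K_u$ ($u\in V$) of the complete graph $K_S$, each with vertices numbered $1,\dots,S$; then, labelling the edges of $E$ as $e_1,\dots,e_{|E|}$, for each $e_i=\{u,v\}$ the $i$-th vertex of $K_u$ is identified with the $i$-th vertex of $K_v$. The cliques $K_u$ refer to these $|V|$ subgraphs. For a clique $K$ with an edge 2-coloring, a dominating color of $K$ is a color $c$ such that some vertex of $K$ has all of its edges within $K$ colored $c$. -}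

module Defs where

open import Data.Nat using (ℕ; zero; suc; _+_; _*_; _≤_; _<?_)
open import Data.Nat.Combinatorics using (_C_)
open import Data.Fin using (Fin; toℕ; fromℕ<)
import Data.Fin as F
open import Data.Fin.Properties using (_≟_)
open import Data.Bool using (Bool; true; false; _∧_; _∨_; not; if_then_else_)
open import Data.List using (List; []; _∷_; _++_; map; concatMap; filter; length)
open import Data.Bool.ListAction using (any)
open import Data.List using (allFin) public
open import Data.Maybe using (Maybe; just; nothing)
open import Data.Product using (Σ; _×_; _,_; proj₁; proj₂; ∃; ∃!)
open import Function.Definitions using (Injective)
open import Relation.Binary.PropositionalEquality using (_≡_; _≢_)
open import Relation.Nullary using (yes; no; ¬_)
open import Relation.Nullary.Decidable using (⌊_⌋)

-- The edges are labelled e_0,…,e_{m-1} by the function `edge`; each edge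
-- {a,b} is stored as the pair (a,b) with a < b (so no loops, and the
-- unordered pair is stored canonically); `edge` injective = no multi-edges.

record SimpleGraph (n m : ℕ) : Set where
  field
    edge     : Fin m → Fin n × Fin n
    edge-lt  : ∀ k → proj₁ (edge k) F.< proj₂ (edge k)
    edge-inj : Injective _≡_ _≡_ edge
open SimpleGraph public

cliqueSize : ℕ → ℕ → ℕ
cliqueSize n m = 4 + 2 * n * (m C 2)

module CliqueExpansion {n m : ℕ} (G : SimpleGraph n m) where

  S : ℕ
  S = cliqueSize n m

  edgeAt : Fin S → Maybe (Fin n × Fin n)
  edgeAt i with toℕ i <? m
  ... | yes p = just (edge G (fromℕ< p))
  ... | no  _ = nothing

  -- The vertex (u,i) (i-th vertex of K_u) is identified with (w,i)
  -- exactly when e_i = {u,w}; `partner u i` returns that w if any.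
  partner : Fin n → Fin S → Maybe (Fin n)
  partner u i with edgeAt i
  ... | nothing = nothing
  ... | just (a , b) =
    if ⌊ u ≟ a ⌋ then just b else (if ⌊ u ≟ b ⌋ then just a else nothing)

  -- Each vertex of K(G) is represented canonically by the pair (u,i)
  -- with u the smallest clique index among its identified copies.
  canonical : Fin n → Fin S → Bool
  canonical u i with partner u i
  ... | nothing = true
  ... | just w  = ⌊ toℕ u <? toℕ w ⌋

  vertices : List (Fin n × Fin S)
  vertices = filter (λ x → Data.Bool._≟_ (canonical (proj₁ x) (proj₂ x)) true)
               (concatMap (λ u → map (λ i → (u , i)) (allFin S)) (allFin n))

  -- Since G is simple, two cliques K_u, K_v share at most
  -- one vertex, so the cliques are edge-disjoint and the edges of K(G) are
  -- exactly the triples (u,i,j) with i < j (the edge {i,j} of K_u).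
  edges : List (Fin n × Fin S × Fin S)
  edges = concatMap (λ u → concatMap (λ i →
            map (λ j → (u , i , j))
              (filter (λ j → toℕ i <? toℕ j) (allFin S)))
            (allFin S)) (allFin n)

  -- An edge 2-coloring of K(G): χ u i j is the colour of edge {i,j} of K_u
  -- for i < j (other values are irrelevant).
  Coloring : Set
  Coloring = Fin n → Fin S → Fin S → Bool

  col : Coloring → Fin n → Fin S → Fin S → Bool
  col χ u i j with toℕ i <? toℕ j
  ... | yes _ = χ u i j
  ... | no  _ = χ u j i

  classSize : Coloring → Bool → ℕ
  classSize χ c =
    length (filter (λ e → Data.Bool._≟_ (χ (proj₁ e) (proj₁ (proj₂ e)) (proj₂ (proj₂ e))) c) edges)

  coloursIn : Coloring → Fin n → Fin S → List Bool
  coloursIn χ u i = map (col χ u i) (filter (λ j → ¬? (i ≟ j)) (allFin S))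
    where open import Relation.Nullary.Decidable using (¬?)

  incidentColours : Coloring → Fin n → Fin S → List Bool
  incidentColours χ u i with partner u i
  ... | nothing = coloursIn χ u i
  ... | just w  = coloursIn χ u i ++ coloursIn χ w i

  isCut : Coloring → Fin n → Fin S → Bool
  isCut χ u i = any (λ c → c) (incidentColours χ u i)
              ∧ any not (incidentColours χ u i)

  numCut : Coloring → ℕ
  numCut χ = length (filter (λ x → Data.Bool._≟_ (isCut χ (proj₁ x) (proj₂ x)) true) vertices)

  -- ε-balanced, with ε = p / n (p = ε|V|):
  -- each colour class has size ≤ (1+ε)|E(K(G))|/2, i.e.
  -- 2 n · |class| ≤ (n + p) · |E(K(G))|.
  Balanced : ℕ → Coloring → Set
  Balanced p χ = ∀ c → 2 * n * classSize χ c ≤ (n + p) * length edges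

  Optimal : ℕ → Coloring → Set
  Optimal p χ = Balanced p χ × (∀ χ' → Balanced p χ' → numCut χ ≤ numCut χ')

  Dominating : Coloring → Fin n → Bool → Set
  Dominating χ u c = ∃ λ (i : Fin S) → ∀ (j : Fin S) → i ≢ j → col χ u i j ≡ c

  ExactlyOneDominating : Coloring → Fin n → Set
  ExactlyOneDominating χ u = ∃! _≡_ (Dominating χ u)

-- The colouring that paints every clique K_u in a single colour, the first h = (1 + ε)|V|/2
-- cliques in one colour and the others in the other, is balanced, and under it only vertices
-- shared by two cliques can be cut; so it cuts at most |E| < S vertices, and so does an optimal
-- colouring. Hence in every K_u some vertex sees a single colour inside K_u (otherwise all S
-- vertices of K_u would be cut), and that colour dominates K_u. Two dominating colours agree,
-- since both are the colour of an edge at their witnesses.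

module Submission where

open import Data.Bool using (Bool; true; false; _∧_; not; T)
import Data.Bool as Bool
open import Data.Bool.ListAction using (any)
open import Data.Bool.Properties using (T-≡; T-not-≡; T-∧)
open import Data.Empty using (⊥-elim)
open import Data.Unit using (tt)
open import Data.Fin using (Fin; toℕ)
import Data.Fin as Fin
open import Data.Fin.Properties using (_≟_; toℕ-injective; toℕ<n; all?; ¬∀⟶∃¬)
open import Data.List using (List; []; _∷_; _++_; map; concatMap; filter; length; cartesianProduct; upTo)
open import Data.List.Membership.Propositional using (_∈_)
open import Data.List.Membership.Propositional.Properties
  using (∈-filter⁺; ∈-filter⁻; ∈-map⁺; ∈-map⁻; ∈-++⁺ˡ; ∈-++⁺ʳ; ∈-allFin; ∈-upTo⁺; ∈-cartesianProduct⁺)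
open import Data.List.Membership.DecPropositional Bool._≟_ using (_∈?_)
open import Data.List.Properties
  using (length-++; filter-++; filter-all; filter-none; length-map; length-tabulate; length-upTo;
         map-concatMap; concatMap-cong; map-∘)
open import Data.List.Relation.Unary.All using (All)
open import Data.List.Relation.Unary.All.Properties using (map⁺)
import Data.List.Relation.Unary.All as All
open import Data.List.Relation.Unary.Any using (here; there)
import Data.List.Relation.Unary.Any as Any
open import Data.List.Relation.Unary.Any.Properties using (any⁺; any⁻)
open import Data.List.Relation.Unary.AllPairs using (_∷_)
open import Data.List.Relation.Unary.Unique.Propositional using (Unique)
open import Data.List.Relation.Unary.Unique.Propositional.Properties using (filter⁺; cartesianProduct⁺; allFin⁺)
open import Data.Maybe using (just; nothing)
open import Data.Maybe.Properties using (just-injective)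
open import Data.Nat using (ℕ; zero; suc; _+_; _*_; _∸_; _≤_; _<_; z≤n; s≤s; _<?_)
open import Data.Nat.Combinatorics using (_C_; nC1≡n; nCk+nC[k+1]≡[n+1]C[k+1])
open import Data.Nat.Divisibility using (_∣_; divides)
open import Data.Nat.Properties hiding (_≟_)
open import Data.Nat.Tactic.RingSolver using (solve-∀)
open import Data.Product using (_×_; _,_; proj₁; proj₂; ∃)
open import Data.Sum using (_⊎_; inj₁; inj₂)
open import Function using (_∘_; case_of_; _⇔_; mk⇔; Equivalence)
open import Relation.Binary.PropositionalEquality
open import Relation.Nullary using (¬_; yes; no; contradiction)
open import Relation.Nullary.Decidable using (⌊_⌋; ¬?; _×-dec_; toWitness; fromWitness)
open import Relation.Unary using (Pred; Decidable)
open import Level using (0ℓ)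

open import Defs

remove-member : ∀ {A : Set} {y : A} {ys : List A} → y ∈ ys →
  ∃ λ zs → length ys ≡ suc (length zs) × (∀ {z} → z ∈ ys → z ≢ y → z ∈ zs)
remove-member {ys = _ ∷ ys} (here refl) = ys , refl , λ where
  (here refl) z≢y → ⊥-elim (z≢y refl)
  (there z∈ys) _  → z∈ys
remove-member {ys = w ∷ _} (there y∈ys) with zs , eq , ⊆zs ← remove-member y∈ys =
  w ∷ zs , cong suc eq , λ where
    (here refl) _    → here refl
    (there z∈ys) z≢y → there (⊆zs z∈ys z≢y)

length-≤-injection : ∀ {A B : Set} (f : A → B) {xs : List A} {ys : List B} → Unique xs →
  (∀ {x y} → x ∈ xs → y ∈ xs → f x ≡ f y → x ≡ y) →
  (∀ {x} → x ∈ xs → f x ∈ ys) → length xs ≤ length ys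
length-≤-injection f {[]} _ _ _ = z≤n
length-≤-injection f {x ∷ xs} (x∉xs ∷ xs!) inj mem
  with zs , |ys|≡1+|zs| , ys⊆zs ← remove-member (mem (here refl)) =
  subst (suc (length xs) ≤_) (sym |ys|≡1+|zs|) (s≤s (length-≤-injection f xs! (λ p q → inj (there p) (there q)) mem′))
  where
  mem′ : ∀ {y} → y ∈ xs → f y ∈ zs
  mem′ y∈xs = ys⊆zs (mem (there y∈xs))
    (λ fy≡fx → All.lookup x∉xs y∈xs (inj (here refl) (there y∈xs) (sym fy≡fx)))

concatMap≡cartesianProduct : ∀ {A B : Set} (xs : List A) (ys : List B) →
  concatMap (λ x → map (x ,_) ys) xs ≡ cartesianProduct xs ys
concatMap≡cartesianProduct []       ys = refl
concatMap≡cartesianProduct (x ∷ xs) ys = cong (map (x ,_) ys ++_) (concatMap≡cartesianProduct xs ys)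

Bichromatic : List Bool → Set
Bichromatic L = true ∈ L × false ∈ L

bichromatic? : Decidable Bichromatic
bichromatic? L = (true ∈? L) ×-dec (false ∈? L)

bichromatic⇔ : ∀ L → (any (λ c → c) L ∧ any not L) ≡ true ⇔ Bichromatic L
bichromatic⇔ L = mk⇔ to from
  where
  to : (any (λ c → c) L ∧ any not L) ≡ true → Bichromatic L
  to eq with t , f ← Equivalence.to T-∧ (Equivalence.from T-≡ eq) =
    Any.map (sym ∘ Equivalence.to T-≡) (any⁻ _ L t) ,
    Any.map (sym ∘ Equivalence.to T-not-≡) (any⁻ not L f)

  from : Bichromatic L → (any (λ c → c) L ∧ any not L) ≡ true
  from (t , f) = Equivalence.to T-≡ (Equivalence.from T-∧
    (any⁺ _ (Any.map (λ t≡x → subst T t≡x tt) t) , any⁺ not (Any.map (λ f≡x → subst (T ∘ not) f≡x tt) f)))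

¬bichromatic⇒constant : ∀ L → ¬ Bichromatic L → ∃ λ c → All (_≡ c) L
¬bichromatic⇒constant L ¬both with true ∈? L
... | yes t∈L = true , All.tabulate (only-true _)
  where
  only-true : ∀ x → x ∈ L → x ≡ true
  only-true true  _   = refl
  only-true false f∈L = ⊥-elim (¬both (t∈L , f∈L))
... | no t∉L = false , All.tabulate (only-false _)
  where
  only-false : ∀ x → x ∈ L → x ≡ false
  only-false true  t∈L = ⊥-elim (t∉L t∈L)
  only-false false _   = refl

constant⇒¬bichromatic : ∀ {L c} → All (_≡ c) L → ¬ Bichromatic L
constant⇒¬bichromatic const (t∈L , f∈L) with All.lookup const t∈L | All.lookup const f∈L
... | refl | ()

module _ {I A : Set} (g : I → List A) {T : ℕ} (|g|≡T : ∀ i → length (g i) ≡ T) where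

  length-concatMap-uniform : ∀ xs → length (concatMap g xs) ≡ length xs * T
  length-concatMap-uniform []       = refl
  length-concatMap-uniform (x ∷ xs) = begin
    length (g x ++ concatMap g xs)         ≡⟨ length-++ (g x) ⟩
    length (g x) + length (concatMap g xs) ≡⟨ cong₂ _+_ (|g|≡T x) (length-concatMap-uniform xs) ⟩
    T + length xs * T                      ∎
    where open ≡-Reasoning

  module _ {Q : Pred A 0ℓ} (Q? : Decidable Q) {R : Pred I 0ℓ} (R? : Decidable R)
           (R⇒Q : ∀ i → R i → All Q (g i)) (¬R⇒¬Q : ∀ i → ¬ R i → All (¬_ ∘ Q) (g i)) where

    length-filter-concatMap-uniform :
      ∀ xs → length (filter Q? (concatMap g xs)) ≡ length (filter R? xs) * T
    length-filter-concatMap-uniform []       = refl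
    length-filter-concatMap-uniform (x ∷ xs)
      rewrite filter-++ Q? (g x) (concatMap g xs) | length-++ (filter Q? (g x)) {filter Q? (concatMap g xs)}
      with R? x
    ... | yes r rewrite filter-all Q? (R⇒Q x r) | |g|≡T x =
      cong (T +_) (length-filter-concatMap-uniform xs)
    ... | no ¬r rewrite filter-none Q? (¬R⇒¬Q x ¬r) = length-filter-concatMap-uniform xs

∃≢ : ∀ {k} (i : Fin (suc (suc k))) → ∃ λ j → i ≢ j
∃≢ Fin.zero    = Fin.suc Fin.zero , λ ()
∃≢ (Fin.suc _) = Fin.zero , λ ()

colourClass : ∀ {n} → (Fin n → Bool) → Bool → List (Fin n)
colourClass colour c = filter (λ u → colour u Bool.≟ c) (allFin _)

colourCount : ∀ {n} → (Fin n → Bool) → Bool → ℕ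
colourCount colour c = length (colourClass colour c)

∈colourClass⇒ : ∀ {n} (colour : Fin n → Bool) {c u} → u ∈ colourClass colour c → colour u ≡ c
∈colourClass⇒ {n} colour {c} = proj₂ ∘ ∈-filter⁻ (λ u → colour u Bool.≟ c) {xs = allFin n}

colourClass-unique : ∀ {n} (colour : Fin n → Bool) c → Unique (colourClass colour c)
colourClass-unique {n} _ _ = filter⁺ _ (allFin⁺ n)

isBelow : ∀ {n} → ℕ → Fin n → Bool
isBelow h u = ⌊ toℕ u <? h ⌋

isBelow≡true⇒< : ∀ {n h} {u : Fin n} → isBelow h u ≡ true → toℕ u < h
isBelow≡true⇒< = toWitness ∘ Equivalence.from T-≡

isBelow≡false⇒≥ : ∀ {n h} {u : Fin n} → isBelow h u ≡ false → h ≤ toℕ u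
isBelow≡false⇒≥ eq = ≮⇒≥ (λ u<h → subst T eq (fromWitness u<h))

colourCount-isBelow≤ : ∀ {n} h → n ≤ h + h → ∀ c → colourCount (isBelow {n} h) c ≤ h
colourCount-isBelow≤ {n} h _ true = ≤-trans
  (length-≤-injection (toℕ {n}) {ys = upTo h} (colourClass-unique (isBelow h) true) (λ _ _ → toℕ-injective)
    (λ u∈ → ∈-upTo⁺ (isBelow≡true⇒< (∈colourClass⇒ (isBelow h) u∈))))
  (≤-reflexive (length-upTo h))
colourCount-isBelow≤ {n} h n≤h+h false = ≤-trans
  (length-≤-injection (λ u → toℕ u ∸ h) {ys = upTo h} (colourClass-unique (isBelow h) false) inj mem)
  (≤-reflexive (length-upTo h))
  where
  h≤ : ∀ {u} → u ∈ colourClass (isBelow h) false → h ≤ toℕ u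
  h≤ u∈ = isBelow≡false⇒≥ (∈colourClass⇒ (isBelow h) u∈)

  mem : ∀ {u} → u ∈ colourClass (isBelow h) false → toℕ u ∸ h ∈ upTo h
  mem {u} u∈ = ∈-upTo⁺ (subst (_≤ h) (+-∸-assoc 1 (h≤ u∈))
    (m≤n+o⇒m∸n≤o (suc (toℕ u)) h (≤-trans (toℕ<n u) n≤h+h)))

  inj : ∀ {u v} → u ∈ colourClass (isBelow h) false → v ∈ colourClass (isBelow h) false →
        toℕ u ∸ h ≡ toℕ v ∸ h → u ≡ v
  inj {u} {v} u∈ v∈ eq = toℕ-injective (begin
    toℕ u           ≡⟨ m∸n+n≡m (h≤ u∈) ⟨
    toℕ u ∸ h + h   ≡⟨ cong (_+ h) eq ⟩
    toℕ v ∸ h + h   ≡⟨ m∸n+n≡m (h≤ v∈) ⟩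
    toℕ v           ∎)
    where open ≡-Reasoning

n≤1+nC2 : ∀ n → n ≤ suc (n C 2)
n≤1+nC2 zero    = z≤n
n≤1+nC2 (suc n) = s≤s (subst (n ≤_) n+nC2≡[1+n]C2 (m≤m+n n (n C 2)))
  where
  n+nC2≡[1+n]C2 : n + n C 2 ≡ suc n C 2
  n+nC2≡[1+n]C2 = trans (cong (_+ n C 2) (sym (nC1≡n n))) (nCk+nC[k+1]≡[n+1]C[k+1] n 1)

m<cliqueSize : ∀ {n} m → 1 ≤ n → m < cliqueSize n m
m<cliqueSize {n} m 1≤n = begin-strict
  m                   ≤⟨ n≤1+nC2 m ⟩
  suc (m C 2)         <⟨ m<n+m (suc (m C 2)) {3} (s≤s z≤n) ⟩
  4 + m C 2           ≡⟨ cong (4 +_) (*-identityˡ (m C 2)) ⟨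
  4 + 1 * (m C 2)     ≤⟨ +-monoʳ-≤ 4 (*-monoˡ-≤ (m C 2) (≤-trans 1≤n (m≤n*m n 2))) ⟩
  4 + 2 * n * (m C 2) ∎
  where open ≤-Reasoning

module _ {n m : ℕ} (G : SimpleGraph n m) where
  open CliqueExpansion G

  edgeAt-just⇒< : ∀ i {e} → edgeAt i ≡ just e → toℕ i < m
  edgeAt-just⇒< i eq with toℕ i <? m
  ... | yes i<m = i<m

  edgeAt-just⇒ordered : ∀ i {a b} → edgeAt i ≡ just (a , b) → toℕ a < toℕ b
  edgeAt-just⇒ordered i eq with toℕ i <? m | eq
  ... | yes i<m | refl = edge-lt G _

  partner-just⇒edgeAt : ∀ u i {w} → partner u i ≡ just w → edgeAt i ≡ just (u , w) ⊎ edgeAt i ≡ just (w , u)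
  partner-just⇒edgeAt u i eq with edgeAt i
  ... | just (a , b) with u ≟ a | u ≟ b | eq
  ...   | yes refl | _        | refl = inj₁ refl
  ...   | no _     | yes refl | refl = inj₂ refl

  edgeAt⇒partner₁ : ∀ {i a b} → edgeAt i ≡ just (a , b) → partner a i ≡ just b
  edgeAt⇒partner₁ {i} {a} eq with edgeAt i | eq
  ... | just _ | refl with a ≟ a
  ...   | yes _   = refl
  ...   | no a≢a = contradiction refl a≢a

  canonical-unshared : ∀ {u i} → partner u i ≡ nothing → canonical u i ≡ true
  canonical-unshared {u} {i} eq with partner u i | eq
  ... | nothing | refl = refl

  canonical-shared : ∀ {u i w} → partner u i ≡ just w → canonical u i ≡ ⌊ toℕ u <? toℕ w ⌋
  canonical-shared {u} {i} eq with partner u i | eq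
  ... | just _ | refl = refl

  incidentColours-unshared : ∀ χ {u i} → partner u i ≡ nothing → incidentColours χ u i ≡ coloursIn χ u i
  incidentColours-unshared χ {u} {i} eq with partner u i | eq
  ... | nothing | refl = refl

  incidentColours-shared : ∀ χ {u i w} → partner u i ≡ just w →
    incidentColours χ u i ≡ coloursIn χ u i ++ coloursIn χ w i
  incidentColours-shared χ {u} {i} eq with partner u i | eq
  ... | just _ | refl = refl

  canonical⇒∈vertices : ∀ {u i} → canonical u i ≡ true → (u , i) ∈ vertices
  canonical⇒∈vertices {u} {i} = ∈-filter⁺ _
    (subst ((u , i) ∈_) (sym (concatMap≡cartesianProduct (allFin n) (allFin S)))
      (∈-cartesianProduct⁺ (∈-allFin u) (∈-allFin i)))

  ∈vertices⇒canonical : ∀ {u i} → (u , i) ∈ vertices → canonical u i ≡ true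
  ∈vertices⇒canonical = proj₂ ∘ ∈-filter⁻ _ {xs = concatMap (λ u → map (u ,_) (allFin S)) (allFin n)}

  cuts : Coloring → List (Fin n × Fin S)
  cuts χ = filter (λ x → isCut χ (proj₁ x) (proj₂ x) Bool.≟ true) vertices

  cuts-unique : ∀ χ → Unique (cuts χ)
  cuts-unique χ = filter⁺ _ (filter⁺ _
    (subst Unique (sym (concatMap≡cartesianProduct (allFin n) (allFin S))) (cartesianProduct⁺ (allFin⁺ n) (allFin⁺ S))))

  ∈cuts⇔ : ∀ χ {u i} → (u , i) ∈ cuts χ ⇔ (canonical u i ≡ true × Bichromatic (incidentColours χ u i))
  ∈cuts⇔ χ = mk⇔
    (λ x∈ → let x∈vertices , cut = ∈-filter⁻ _ {xs = vertices} x∈ in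
       ∈vertices⇒canonical x∈vertices , Equivalence.to (bichromatic⇔ _) cut)
    (λ (canon , both) → ∈-filter⁺ _ (canonical⇒∈vertices canon) (Equivalence.from (bichromatic⇔ _) both))

  edgeAt⇒canonical : ∀ {i a b} → edgeAt i ≡ just (a , b) → canonical a i ≡ true
  edgeAt⇒canonical {i} eq = trans (canonical-shared (edgeAt⇒partner₁ eq))
    (Equivalence.to T-≡ (fromWitness (edgeAt-just⇒ordered i eq)))

  edgeAt⇒incidentColours : ∀ χ {i a b} → edgeAt i ≡ just (a , b) →
    incidentColours χ a i ≡ coloursIn χ a i ++ coloursIn χ b i
  edgeAt⇒incidentColours χ eq = incidentColours-shared χ (edgeAt⇒partner₁ eq)

  representative : ∀ χ u i → ∃ λ w →
    canonical w i ≡ true × (∀ {c} → c ∈ coloursIn χ u i → c ∈ incidentColours χ w i)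
  representative χ u i with partner u i in pu
  ... | nothing = u , canonical-unshared pu , subst (_ ∈_) (sym (incidentColours-unshared χ pu))
  ... | just w with partner-just⇒edgeAt u i pu
  ...   | inj₁ e = u , edgeAt⇒canonical e , subst (_ ∈_) (sym (edgeAt⇒incidentColours χ e)) ∘ ∈-++⁺ˡ
  ...   | inj₂ e = w , edgeAt⇒canonical e , subst (_ ∈_) (sym (edgeAt⇒incidentColours χ e)) ∘ ∈-++⁺ʳ _

  S≤numCut : ∀ χ u → (∀ i → Bichromatic (coloursIn χ u i)) → S ≤ numCut χ
  S≤numCut χ u bichromatic = begin
    S                  ≡⟨ length-tabulate (λ i → i) ⟨
    length (allFin S)  ≤⟨ length-≤-injection vertexOf (allFin⁺ S) (λ _ _ → cong proj₂) (λ {i} _ → vertexOf∈cuts i) ⟩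
    numCut χ           ∎
    where
    open ≤-Reasoning

    vertexOf : Fin S → Fin n × Fin S
    vertexOf i = proj₁ (representative χ u i) , i

    vertexOf∈cuts : ∀ i → (proj₁ (representative χ u i) , i) ∈ cuts χ
    vertexOf∈cuts i with representative χ u i | bichromatic i
    ... | w , canon , ⊆incident | t , f = Equivalence.from (∈cuts⇔ χ) (canon , ⊆incident t , ⊆incident f)

  monochromatic : (Fin n → Bool) → Coloring
  monochromatic colour u i j = colour u

  col-monochromatic : ∀ colour u i j → col (monochromatic colour) u i j ≡ colour u
  col-monochromatic colour u i j with toℕ i <? toℕ j
  ... | yes _ = refl
  ... | no _  = refl

  coloursIn-monochromatic : ∀ colour u i → All (_≡ colour u) (coloursIn (monochromatic colour) u i)
  coloursIn-monochromatic colour u i = All.tabulate λ c∈ → case ∈-map⁻ _ c∈ of λ where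
    (j , _ , refl) → col-monochromatic colour u i j

  cut-monochromatic⇒edgeAt : ∀ colour {u i} → (u , i) ∈ cuts (monochromatic colour) →
    ∃ λ w → edgeAt i ≡ just (u , w)
  cut-monochromatic⇒edgeAt colour {u} {i} u∈ with Equivalence.to (∈cuts⇔ _) u∈ | partner u i in pu
  ... | _ , both | nothing = contradiction (subst Bichromatic (incidentColours-unshared _ pu) both)
                               (constant⇒¬bichromatic (coloursIn-monochromatic colour u i))
  ... | canon , _ | just w with partner-just⇒edgeAt u i pu
  ...   | inj₁ e = w , e
  ...   | inj₂ e = contradiction (edgeAt-just⇒ordered i e)
                     (<-asym (toWitness (Equivalence.from T-≡ (trans (sym (canonical-shared pu)) canon))))

  numCut-monochromatic≤m : ∀ colour → numCut (monochromatic colour) ≤ m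
  numCut-monochromatic≤m colour = begin
    numCut (monochromatic colour) ≤⟨ length-≤-injection (toℕ ∘ proj₂) (cuts-unique _) inj mem ⟩
    length (upTo m)               ≡⟨ length-upTo m ⟩
    m                             ∎
    where
    open ≤-Reasoning

    inj : ∀ {x y} → x ∈ cuts (monochromatic colour) → y ∈ cuts (monochromatic colour) →
          toℕ (proj₂ x) ≡ toℕ (proj₂ y) → x ≡ y
    inj {u , i} {v , j} x∈ y∈ eq with toℕ-injective eq
    ... | refl with cut-monochromatic⇒edgeAt colour x∈ | cut-monochromatic⇒edgeAt colour y∈
    ...   | _ , e | _ , e′ = cong (_, i) (cong proj₁ (just-injective (trans (sym e) e′)))

    mem : ∀ {x} → x ∈ cuts (monochromatic colour) → toℕ (proj₂ x) ∈ upTo m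
    mem {u , i} x∈ = ∈-upTo⁺ (edgeAt-just⇒< i (proj₂ (cut-monochromatic⇒edgeAt colour x∈)))

  orderedPairs : List (Fin S × Fin S)
  orderedPairs = concatMap (λ i → map (i ,_) (filter (λ j → toℕ i <? toℕ j) (allFin S))) (allFin S)

  cliqueEdges : Fin n → List (Fin n × Fin S × Fin S)
  cliqueEdges u = map (u ,_) orderedPairs

  edges≡concatMap-cliqueEdges : edges ≡ concatMap cliqueEdges (allFin n)
  edges≡concatMap-cliqueEdges = concatMap-cong
    (λ u → sym (trans (map-concatMap (u ,_) (λ i → map (i ,_) (later i)) (allFin S))
      (concatMap-cong (λ i → sym (map-∘ {g = u ,_} {f = i ,_} (later i))) (allFin S))))
    (allFin n)
    where
    later : Fin S → List (Fin S)
    later i = filter (λ j → toℕ i <? toℕ j) (allFin S)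

  length-cliqueEdges : ∀ u → length (cliqueEdges u) ≡ length orderedPairs
  length-cliqueEdges u = length-map (u ,_) orderedPairs

  length-edges : length edges ≡ n * length orderedPairs
  length-edges = begin
    length edges                              ≡⟨ cong length edges≡concatMap-cliqueEdges ⟩
    length (concatMap cliqueEdges (allFin n)) ≡⟨ length-concatMap-uniform cliqueEdges length-cliqueEdges (allFin n) ⟩
    length (allFin n) * length orderedPairs   ≡⟨ cong (_* length orderedPairs) (length-tabulate {n = n} (λ u → u)) ⟩
    n * length orderedPairs                   ∎
    where open ≡-Reasoning

  classSize-monochromatic : ∀ colour c →
    classSize (monochromatic colour) c ≡ colourCount colour c * length orderedPairs
  classSize-monochromatic colour c = trans
    (cong (length ∘ filter (λ e → colour (proj₁ e) Bool.≟ c)) edges≡concatMap-cliqueEdges)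
    (length-filter-concatMap-uniform cliqueEdges length-cliqueEdges _ _
      (λ u colour≡c → map⁺ (All.universal (λ _ → colour≡c) orderedPairs))
      (λ u colour≢c → map⁺ (All.universal (λ _ → colour≢c) orderedPairs))
      (allFin n))

  monochromatic-balanced : ∀ {p} colour → (∀ c → 2 * colourCount colour c ≤ n + p) →
    Balanced p (monochromatic colour)
  monochromatic-balanced {p} colour 2count≤n+p c = begin
    2 * n * classSize (monochromatic colour) c ≡⟨ cong (2 * n *_) (classSize-monochromatic colour c) ⟩
    2 * n * (colourCount colour c * #pairs)    ≡⟨ swap n (colourCount colour c) #pairs ⟩
    2 * colourCount colour c * (n * #pairs)    ≤⟨ *-monoˡ-≤ (n * #pairs) (2count≤n+p c) ⟩
    (n + p) * (n * #pairs)                     ≡⟨ cong ((n + p) *_) length-edges ⟨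
    (n + p) * length edges                     ∎
    where
    open ≤-Reasoning

    #pairs : ℕ
    #pairs = length orderedPairs

    swap : ∀ a b c → 2 * a * (b * c) ≡ 2 * b * (a * c)
    swap = solve-∀

  col-sym : ∀ χ u {i j} → i ≢ j → col χ u i j ≡ col χ u j i
  col-sym χ u {i} {j} i≢j with toℕ i <? toℕ j | toℕ j <? toℕ i
  ... | yes i<j | yes j<i = contradiction j<i (<-asym i<j)
  ... | yes _   | no _    = refl
  ... | no _    | yes _   = refl
  ... | no i≮j  | no j≮i  = contradiction (toℕ-injective (≤-antisym (≮⇒≥ j≮i) (≮⇒≥ i≮j))) i≢j

  col∈coloursIn : ∀ χ u {i j} → i ≢ j → col χ u i j ∈ coloursIn χ u i
  col∈coloursIn χ u {i} {j} i≢j = ∈-map⁺ (col χ u i) (∈-filter⁺ (λ j → ¬? (i ≟ j)) (∈-allFin j) i≢j)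

  dominating-exists : ∀ χ u → numCut χ < S → ∃ (Dominating χ u)
  dominating-exists χ u numCut<S with all? (λ i → bichromatic? (coloursIn χ u i))
  ... | yes allBichromatic = contradiction (S≤numCut χ u allBichromatic) (<⇒≱ numCut<S)
  ... | no ¬allBichromatic
    with i , ¬bichromatic ← ¬∀⟶∃¬ S _ (λ i → bichromatic? (coloursIn χ u i)) ¬allBichromatic
    with c , constant ← ¬bichromatic⇒constant _ ¬bichromatic
    = c , i , λ j i≢j → All.lookup constant (col∈coloursIn χ u i≢j)

  dominating-unique : ∀ χ u {c c′} → Dominating χ u c → Dominating χ u c′ → c ≡ c′
  dominating-unique χ u (i , dom) (i′ , dom′) with i ≟ i′
  ... | no i≢i′ = trans (sym (dom i′ i≢i′)) (trans (col-sym χ u i≢i′) (dom′ i (i≢i′ ∘ sym)))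
  ... | yes refl with j , i≢j ← ∃≢ i = trans (sym (dom j i≢j)) (dom′ j i≢j)

  exactlyOneDominating : ∀ χ u → numCut χ < S → ExactlyOneDominating χ u
  exactlyOneDominating χ u numCut<S with c , dom ← dominating-exists χ u numCut<S =
    c , dom , dominating-unique χ u dom

mainTheorem4 : (n m : ℕ) (G : SimpleGraph n m) (p : ℕ) → p < n → 2 ∣ (n + p)
    → (χ : CliqueExpansion.Coloring G) → CliqueExpansion.Optimal G p χ
    → (u : Fin n) → CliqueExpansion.ExactlyOneDominating G χ u
mainTheorem4 n m G p p<n (divides h n+p≡h*2) χ (_ , optimal) u = exactlyOneDominating G χ u numCut<S
  where
  open CliqueExpansion G

  2*h≡n+p : 2 * h ≡ n + p
  2*h≡n+p = trans (*-comm 2 h) (sym n+p≡h*2)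

  halves : Coloring
  halves = monochromatic G (isBelow h)

  halves-balanced : Balanced p halves
  halves-balanced = monochromatic-balanced G (isBelow h) λ c →
    ≤-trans (*-monoʳ-≤ 2 (colourCount-isBelow≤ h n≤h+h c)) (≤-reflexive 2*h≡n+p)
    where
    n≤h+h : n ≤ h + h
    n≤h+h = ≤-trans (m≤m+n n p) (≤-reflexive (trans (sym 2*h≡n+p) (cong (h +_) (+-identityʳ h))))

  numCut<S : numCut χ < S
  numCut<S = begin-strict
    numCut χ      ≤⟨ optimal halves halves-balanced ⟩
    numCut halves ≤⟨ numCut-monochromatic≤m G (isBelow h) ⟩
    m             <⟨ m<cliqueSize m (≤-trans (s≤s z≤n) p<n) ⟩
    S             ∎
    where open ≤-Reasoning
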